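{- Let $(\rho,f,R,p,g)$ be a cellular bisimulation between cellular automata $\gamma\colon X\to CX$ and $\delta\colon Y\to CY$, where $\rho\colon Q\to CQ$ and $f_1\colon\rho\to\gamma$, $f_2\colon\rho\to\delta$. Then for every $u\in Q$, the span $X^*\xleftarrow{p_1}R\xrightarrow{p_2}Y^*$ is a logical equivalence between $(\gamma,f_1(u))$ and $(\delta,f_2(u))$; that is, for all $r\in R$ and all modal formulas $\varphi$, $(\gamma,f_1(u),p_1(r))\models\varphi$ iff $(\delta,f_2(u),p_2(r))\models\varphi$.
   Context: Fix a monoid $(M,\cdot,e)$, a subset $N\subseteq M$ with inclusion $i\colon N\hookrightarrow M$, and a set $S$ of states. $[A,B]$ is the set of maps $A\to B$. For $a\colon M\to X$ let $I^a\subseteq[N,S]$ be the set of $f\colon N\to S$ with $f(n)=f(n')$ whenever $a(i(n))=a(i(n'))$; for $h\colon X\to Y$, $I^{h\circ a}\subseteq I^a$. Let $CX=\coprod_{a\colon M\to X}[I^a,S]$, $(Ch)(a,f)=(h\circ a, f|_{I^{h\circ a}})$. A cellular automaton is $\gamma\colon X\to CX$, $\gamma(x)=(\gamma_1(x),\gamma_2(x))$ with $\gamma_1(x)\colon M\to X$, $\gamma_2(x)\colon I^{\gamma_1(x)}\to S$, such that $\gamma_1(x)(e)=x$ and $\gamma_1(\gamma_1(x)(m))(n)=\gamma_1(x)(n\cdot m)$. A pre-cellular morphism $h\colon\gamma\to\delta$ is a map with $Ch\circ\gamma=\delta\circ h$. Configurations $X^*=[X,S]$; $h^*(c)=c\circ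 h$. Global rule $G_\gamma(c)(x)=\gamma_2(x)(c\circ\gamma_1(x)\circ i)$. A cellular bisimulation between $\gamma$ and $\delta$ is a tuple $(\rho,f,R,p,g)$: a cellular automaton $\rho\colon Q\to CQ$, pre-cellular morphisms $f_1\colon\rho\to\gamma$, $f_2\colon\rho\to\delta$, a set $R$ with maps $p_1\colon R\to X^*$, $p_2\colon R\to Y^*$, and $g\colon R\to R$, such that $f_1^*\circ p_1=f_2^*\circ p_2$, $p_1\circ g=G_\gamma\circ p_1$ and $p_2\circ g=G_\delta\circ p_2$. Modal formulas: $\varphi::=s\mid\neg\varphi\mid\bigvee_{j\in J}\varphi_j\mid\langle m\rangle\varphi\mid\bigcirc\varphi$ ($s\in S$, $m\in M$, $J$ arbitrary). Semantics: $(\gamma,x,c)\models s$ iff $c(x)=s$; $\neg,\bigvee$ classical; $(\gamma,x,c)\models\langle m\rangle\varphi$ iff $(\gamma,\gamma_1(x)(m),c)\models\varphi$; $(\gamma,x,c)\models\bigcirc\varphi$ iff $(\gamma,x,G_\gamma(c))\models\varphi$. A logical equivalence between based automata $(\gamma,x_0)$, $(\delta,y_0)$ is a span $X^*\xleftarrow{p_1}R\xrightarrow{p_2}Y^*$ with $(\gamma,x_0,p_1(r))\models\varphi\iff(\delta,y_0,p_2(r))\models\varphi$ for all $r\in R$ and formulas $\varphi$. -}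

module Defs where

open import Level using (0ℓ)
open import Data.Product using (Σ; _,_; proj₁; proj₂)
open import Function using (_∘_)
open import Relation.Nullary using (¬_)
open import Relation.Unary using (Pred)
open import Relation.Binary.PropositionalEquality using (_≡_; cong)
open import Algebra.Structures using (IsMonoid)

record Setting : Set₁ where
  field
    M        : Set
    _·_      : M → M → M
    e        : M
    isMonoid : IsMonoid _≡_ _·_ e
    N        : Pred M 0ℓ
    S        : Set

module Cellular (𝒮 : Setting) where
  open Setting 𝒮

  Nˢ : Set
  Nˢ = Σ M N

  ι : Nˢ → M
  ι = proj₁

  -- I^a ⊆ [N,S]: maps f with f n = f n' whenever a (i n) = a (i n').
  -- Membership proof is irrelevant, so I^a behaves as a genuine subset.
  record I {X : Set} (a : M → X) : Set where
    constructor mkI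
    field
      fn : Nˢ → S
      .resp : ∀ n n' → a (ι n) ≡ a (ι n') → fn n ≡ fn n'
  open I public

  C : Set → Set
  C X = Σ (M → X) (λ a → I a → S)

  incl : {X Y : Set} (h : X → Y) (a : M → X) → I (h ∘ a) → I a
  incl h a (mkI f r) = mkI f (λ n n' eq → r n n' (cong h eq))

  Cmap : {X Y : Set} → (X → Y) → C X → C Y
  Cmap h t = (h ∘ proj₁ t , λ j → proj₂ t (incl h (proj₁ t) j))

  record CA (X : Set) : Set where
    field
      γ    : X → C X
    γ₁ : X → M → X
    γ₁ x = proj₁ (γ x)
    γ₂ : (x : X) → I (γ₁ x) → S
    γ₂ x = proj₂ (γ x)
    field
      unit : ∀ x → γ₁ x e ≡ x
      comp : ∀ x m n → γ₁ (γ₁ x m) n ≡ γ₁ x (n · m)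
  open CA public

  record PreMor {Q X : Set} (ρ : CA Q) (γ' : CA X) : Set where
    field
      map  : Q → X
      comm : ∀ q → Cmap map (γ ρ q) ≡ γ γ' (map q)
  open PreMor public

  _* : Set → Set
  X * = X → S

  G : {X : Set} → CA X → X * → X *
  G γ' c x = γ₂ γ' x (mkI (c ∘ γ₁ γ' x ∘ ι) (λ n n' eq → cong c eq))

  record CellularBisim {X Y : Set} (γ' : CA X) (δ : CA Y) : Set₁ where
    field
      Q  : Set
      ρ  : CA Q
      f₁ : PreMor ρ γ'
      f₂ : PreMor ρ δ
      R  : Set
      p₁ : R → X *
      p₂ : R → Y *
      g  : R → R
      square : ∀ r → p₁ r ∘ map f₁ ≡ p₂ r ∘ map f₂
      step₁  : ∀ r → p₁ (g r) ≡ G γ' (p₁ r)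
      step₂  : ∀ r → p₂ (g r) ≡ G δ (p₂ r)

  data Form : Set₁ where
    st   : S → Form
    ¬ᶠ   : Form → Form
    ⋁    : (J : Set) → (J → Form) → Form
    ⟨_⟩_ : M → Form → Form
    ○    : Form → Form

  Sat : {X : Set} → CA X → X → X * → Form → Set
  Sat γ' x c (st s)    = c x ≡ s
  Sat γ' x c (¬ᶠ φ)    = ¬ Sat γ' x c φ
  Sat γ' x c (⋁ J φs)  = Σ J (λ j → Sat γ' x c (φs j))
  Sat γ' x c (⟨ m ⟩ φ) = Sat γ' (γ₁ γ' x m) c φ
  Sat γ' x c (○ φ)     = Sat γ' x (G γ' c) φ

{-# OPTIONS --safe #-}
module Submission where

open import Defs
open import Data.Product using (proj₁)
open import Function.Bundles using (_⇔_; mk⇔)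
open import Function.Related.Propositional using (equivalence)
open import Function.Related.TypeIsomorphisms using (¬-cong-⇔)
import Data.Product.Function.Dependent.Propositional as Σ
open import Relation.Binary.PropositionalEquality
  using (_≡_; sym; trans; cong; cong-app; subst₂)

-- Induction on φ for all cells u ∈ Q and all r ∈ R at once: ⟨ m ⟩ moves u to its
-- m-neighbour in ρ, which f₁ and f₂ preserve, and ○ moves r to g r, which p₁ and p₂
-- turn into the global rules of γ and δ.

module _ (𝒮 : Setting) where
  open Cellular 𝒮

  map-γ₁ : {Q X : Set} {ρ : CA Q} {γ : CA X} (h : PreMor ρ γ) (q : Q) (m : Setting.M 𝒮) →
           map h (γ₁ ρ q m) ≡ γ₁ γ (map h q) m
  map-γ₁ h q m = cong-app (cong proj₁ (comm h q)) m

  module _ {X Y : Set} {γ : CA X} {δ : CA Y} (B : CellularBisim γ δ) where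
    open CellularBisim B

    Sat-bisim : (φ : Form) (u : Q) (r : R) →
                Sat γ (map f₁ u) (p₁ r) φ ⇔ Sat δ (map f₂ u) (p₂ r) φ
    Sat-bisim (st s) u r = mk⇔ (trans (sym p₁≡p₂)) (trans p₁≡p₂)
      where
      p₁≡p₂ : p₁ r (map f₁ u) ≡ p₂ r (map f₂ u)
      p₁≡p₂ = cong-app (square r) u
    Sat-bisim (¬ᶠ φ) u r = ¬-cong-⇔ (Sat-bisim φ u r)
    Sat-bisim (⋁ J φs) u r = Σ.congˡ {k = equivalence} λ {j} → Sat-bisim (φs j) u r
    Sat-bisim (⟨ m ⟩ φ) u r =
      subst₂ (λ x y → Sat γ x (p₁ r) φ ⇔ Sat δ y (p₂ r) φ)
             (map-γ₁ f₁ u m) (map-γ₁ f₂ u m) (Sat-bisim φ (γ₁ ρ u m) r)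
    Sat-bisim (○ φ) u r =
      subst₂ (λ c d → Sat γ (map f₁ u) c φ ⇔ Sat δ (map f₂ u) d φ)
             (step₁ r) (step₂ r) (Sat-bisim φ u (g r))

theorem2 : (𝒮 : Setting) → let open Cellular 𝒮 in
    {X Y : Set} (γ : CA X) (δ : CA Y) (B : CellularBisim γ δ) →
      let open CellularBisim B in
      (u : Q) (r : R) (φ : Form) →
        Sat γ (map f₁ u) (p₁ r) φ ⇔ Sat δ (map f₂ u) (p₂ r) φ
theorem2 𝒮 γ δ B u r φ = Sat-bisim 𝒮 B φ u r
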